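{- Let $\mathcal{F}$ be the filter monad on $\mathbf{Set}$, i.e. the monad induced by the dual adjunction $\mathbf{Set}(-,2)\dashv\mathbf{MSL}(-,2)\colon\mathbf{MSL}^{\mathrm{op}}\to\mathbf{Set}$, so $\mathcal{F}X=\mathbf{MSL}(\mathbf{Set}(X,2),2)$ is the set of filters on $X$. Then $\mathcal{F}$ is the codensity monad of the forgetful functor $U\colon\mathbf{MSL}_{\mathsf f}\to\mathbf{Set}$, and $\mathcal{F}$ is also the codensity monad of the functor $U_{\mathcal{P}_{\mathsf f}}\colon\mathbf{Kl}_{\mathsf f}(\mathcal{P}_{\mathsf f})\to\mathbf{Set}$.
   Context: $\mathbf{MSL}$ is the category of meet-semilattices with top element and maps preserving finite meets and top; $\mathbf{MSL}_{\mathsf f}$ is its full subcategory of finite ones. $2=\{0,1\}$ is the two-element meet-semilattice (meet = minimum). $\mathbf{Set}(X,2)$ carries the pointwise meet-semilattice structure, and $\mathbf{MSL}(M,2)$ is a set; a morphism $M\to 2$ corresponds to a filter (nonempty, upward closed, meet-closed subset) of $M$. $\mathcal{P}_{\mathsf f}$ is the finite power set monad on $\mathbf{Set}$; $\mathbf{Kl}_{\mathsf f}(\mathcal{P}_{\mathsf f})$ is the full subcategory of its Kleisli category on finite sets (objects finite sets, morphisms $f\colon X\to\mathcal{P}_{\mathsf f}Y$ with Kleisli composition), and $U_{\mathcal{P}_{\mathsf f}}$ sends $X$ to $\mathcal{P}_{\mathsf f}X$ and $f$ to $f^\#\colon A\mapsto\bigcup_{x\in A}f(x)$. The codensity monad of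 a functor $F$ is the right Kan extension $\mathrm{Ran}_FF$ with its canonical monad structure induced by the universal property (unit corresponding to $\mathrm{id}_F$, multiplication corresponding to the twofold counit); "is the codensity monad" means isomorphic as monads. -}

module Defs where

open import Level using (Level; _⊔_) renaming (suc to lsuc)
open import Data.Bool using (Bool; true; false; _∧_; if_then_else_)
open import Data.Nat using (ℕ; zero; suc)
open import Data.Fin using (Fin)
import Data.Fin as Fin
open import Data.Fin.Subset using (Subset; _∪_) renaming (⊥ to ∅)
open import Data.Vec using ([]; _∷_)
open import Data.Product using (Σ; _×_; _,_)
open import Function using (_∘_; id; _↔_)
open import Relation.Binary.PropositionalEquality
  using (_≡_; refl; trans; sym; cong; cong₂)

-- The category Set: Agda types (in Set), functions, equality of
-- morphisms = pointwise equality.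

record Endo : Set₁ where
  field
    F₀     : Set → Set
    F₁     : {A B : Set} → (A → B) → F₀ A → F₀ B
    F-resp : {A B : Set} {f g : A → B} → (∀ a → f a ≡ g a) →
             ∀ x → F₁ f x ≡ F₁ g x
    F-id   : {A : Set} (x : F₀ A) → F₁ id x ≡ x
    F-∘    : {A B C : Set} (f : A → B) (g : B → C) (x : F₀ A) →
             F₁ (g ∘ f) x ≡ F₁ g (F₁ f x)

-- A functor K : C → Set out of some category C (only the data used in
-- the universal property of a right Kan extension: objects, morphisms,
-- and the action of K on them).
record SetFunctor (o h : Level) : Set (lsuc (o ⊔ h)) where
  field
    Obj : Set o
    Hom : Obj → Obj → Set h
    ob  : Obj → Set
    map : {a b : Obj} → Hom a b → ob a → ob b

-- The filter monad  F X = MSL(Set(X,2),2).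
-- Set(X,2) = X → Bool with pointwise meet, top = const true, and
-- equality = pointwise equality; a morphism must respect that equality.

record Filter (X : Set) : Set where
  field
    h     : (X → Bool) → Bool
    resp  : (p q : X → Bool) → (∀ x → p x ≡ q x) → h p ≡ h q
    pres⊤ : h (λ _ → true) ≡ true
    pres∧ : (p q : X → Bool) → h (λ x → p x ∧ q x) ≡ h p ∧ h q
open Filter public

_≈F_ : {X : Set} → Filter X → Filter X → Set
φ ≈F ψ = ∀ p → h φ p ≡ h ψ p

mapF : {X Y : Set} → (X → Y) → Filter X → Filter Y
mapF f φ = record
  { h     = λ p → h φ (p ∘ f)
  ; resp  = λ p q e → resp φ (p ∘ f) (q ∘ f) (e ∘ f)
  ; pres⊤ = pres⊤ φ
  ; pres∧ = λ p q → pres∧ φ (p ∘ f) (q ∘ f)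
  }

ηF : (X : Set) → X → Filter X
ηF X x = record
  { h = λ p → p x ; resp = λ p q e → e x ; pres⊤ = refl ; pres∧ = λ p q → refl }

μF : {X : Set} → Filter (Filter X) → Filter X
μF Φ = record
  { h     = λ p → h Φ (λ φ → h φ p)
  ; resp  = λ p q e → resp Φ _ _ (λ φ → resp φ p q e)
  ; pres⊤ = trans (resp Φ _ _ (λ φ → pres⊤ φ)) (pres⊤ Φ)
  ; pres∧ = λ p q → trans (resp Φ _ _ (λ φ → pres∧ φ p q))
                          (pres∧ Φ (λ φ → h φ p) (λ φ → h φ q))
  }

module _ {o ℓ : Level} (K : SetFunctor o ℓ) where
  open SetFunctor K

  record NatGK (G : Endo) : Set (o ⊔ ℓ) where
    field
      α   : (a : Obj) → Endo.F₀ G (ob a) → ob a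
      nat : {a b : Obj} (f : Hom a b) (x : Endo.F₀ G (ob a)) →
            α b (Endo.F₁ G (map f) x) ≡ map f (α a x)

  record Counit : Set (o ⊔ ℓ) where
    field
      ε     : (a : Obj) → Filter (ob a) → ob a
      ε-resp : (a : Obj) (φ ψ : Filter (ob a)) → φ ≈F ψ → ε a φ ≡ ε a ψ
      ε-nat : {a b : Obj} (f : Hom a b) (φ : Filter (ob a)) →
              ε b (mapF (map f) φ) ≡ map f (ε a φ)

record NatToF (G : Endo) : Set₁ where
  field
    σ     : (X : Set) → Endo.F₀ G X → Filter X
    σ-nat : {X Y : Set} (f : X → Y) (x : Endo.F₀ G X) →
            σ Y (Endo.F₁ G f x) ≈F mapF f (σ X x)

module _ {o ℓ : Level} (K : SetFunctor o ℓ) where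
  open SetFunctor K

  IsRan : Counit K → Set (lsuc Level.zero ⊔ o ⊔ ℓ)
  IsRan E = (G : Endo) (A : NatGK K G) →
      Σ (NatToF G) (Factors G A)
    × ((s t : NatToF G) → Factors G A s → Factors G A t →
         (X : Set) (x : Endo.F₀ G X) → NatToF.σ s X x ≈F NatToF.σ t X x)
    where
      Factors : (G : Endo) → NatGK K G → NatToF G → Set o
      Factors G A s = (a : Obj) (x : Endo.F₀ G (ob a)) →
        Counit.ε E a (NatToF.σ s (ob a) x) ≡ NatGK.α A a x

  -- F is the codensity monad of K: there is a counit ε making (F, ε)
  -- the right Kan extension Ran_K K, and the canonical monad structure
  -- it induces is the filter monad:  the unit ηF corresponds to id_K
  -- (ε ∘ ηF K = id) and the multiplication μF to the twofold counit
  -- (ε ∘ μF K = ε ∘ F ε).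
  IsFilterCodensity : Set (lsuc Level.zero ⊔ o ⊔ ℓ)
  IsFilterCodensity = Σ (Counit K) λ E →
      IsRan E
    × ((a : Obj) (x : ob a) → Counit.ε E a (ηF (ob a) x) ≡ x)
    × ((a : Obj) (Φ : Filter (Filter (ob a))) →
         Counit.ε E a (μF Φ) ≡ Counit.ε E a (mapF (Counit.ε E a) Φ))

record MSL : Set₁ where
  field
    Carrier  : Set
    _⊓_      : Carrier → Carrier → Carrier
    top      : Carrier
    ⊓-assoc  : ∀ x y z → (x ⊓ y) ⊓ z ≡ x ⊓ (y ⊓ z)
    ⊓-comm   : ∀ x y → x ⊓ y ≡ y ⊓ x
    ⊓-idem   : ∀ x → x ⊓ x ≡ x
    top-max  : ∀ x → x ⊓ top ≡ x

record MSL-Hom (M N : MSL) : Set where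
  private
    module M = MSL M
    module N = MSL N
  field
    fun   : M.Carrier → N.Carrier
    pres⊓ : ∀ x y → fun (x M.⊓ y) ≡ fun x N.⊓ fun y
    prestop : fun M.top ≡ N.top

record FinMSL : Set₁ where
  field
    msl    : MSL
    size   : ℕ
    finite : MSL.Carrier msl ↔ Fin size

U-MSLf : SetFunctor (lsuc Level.zero) Level.zero
U-MSLf = record
  { Obj = FinMSL
  ; Hom = λ M N → MSL-Hom (FinMSL.msl M) (FinMSL.msl N)
  ; ob  = λ M → MSL.Carrier (FinMSL.msl M)
  ; map = MSL-Hom.fun
  }

-- Kl_f(P_f): finite sets are represented by Fin n (a skeleton), the
-- finite power set of Fin n by Subset n = Vec Bool n, a Kleisli map
-- Fin m → P_f(Fin n) by Fin m → Subset n, and U_{P_f} f = f^#.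

_♯ : {m n : ℕ} → (Fin m → Subset n) → Subset m → Subset n
_♯ {zero}  f []      = ∅
_♯ {suc m} f (b ∷ A) = (if b then f Fin.zero else ∅) ∪ ((f ∘ Fin.suc) ♯) A

U-KlPf : SetFunctor Level.zero Level.zero
U-KlPf = record
  { Obj = ℕ
  ; Hom = λ m n → Fin m → Subset n
  ; ob  = Subset
  ; map = _♯
  }

{-# OPTIONS --safe #-}
module Submission where

-- A filter on a finite set is principal, generated by its support: the points whose
-- singleton meets every member.  For a finite meet-semilattice M the counit sends φ to the
-- meet of its support, the element characterised by "↑ m ∈ φ iff m ≤ ε φ", from which
-- naturality and the monad laws follow.  For Kl_f(P_f) it sends a filter φ on P(n) to the
-- set of those i for which {A | i ∈ A} meets every member of φ.  A factorisation σ of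
-- α : G K ⇒ K through the counit is determined by a single object: h (σ x) p = α₂ (G p x)
-- for MSL_f, and dually ◇ (σ x) p = α₁ (G p x) for Kl_f(P_f).  These formulas define
-- filters by naturality of α at ⊤, ∧ : 2 × 2 → 2 and the projections, resp. at the Kleisli
-- maps 0 → 1, the union 2 → 1 and the projections n → 1.

open import Algebra.Bundles using (CommutativeMonoid)
open import Algebra.Lattice.Bundles using (Semilattice)
open import Algebra.Lattice.Properties.Semilattice using (∧-orderTheoreticMeetSemilattice)
open import Data.Bool using (Bool; true; false; _∧_; _∨_; not; if_then_else_)
open import Data.Bool.Properties
  using ( not-involutive; ∧-assoc; ∧-comm; ∧-idem; ∧-identityʳ; ∧-zeroʳ; ∨-identityʳ
        ; ∨-∧-booleanAlgebra; ∧-commutativeMonoid )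
open import Data.Fin using (Fin; zero; suc)
open import Data.Fin.Properties using (_≟_; 2↔Bool; *↔×)
open import Data.Fin.Subset using (Subset) renaming (⊥ to ∅)
open import Data.Nat using (ℕ; zero; suc; _*_)
open import Data.Product using (_×_; _,_; proj₁; proj₂; <_,_>)
open import Data.Product.Function.NonDependent.Propositional using (_×-↔_)
open import Data.Vec using (Vec; []; _∷_; lookup; tabulate)
open import Data.Vec.Properties
  using (lookup-zipWith; lookup-replicate; lookup∘tabulate; tabulate∘lookup; tabulate-cong)
open import Data.Vec.Functional using (foldr)
open import Data.Vec.Functional.Relation.Binary.Pointwise.Properties using (foldr-cong)
open import Function using (_∘_; id)
open import Function.Bundles using (Inverse)
open import Function.Properties.Inverse using (↔⇒↣; ↔-sym; ↔-trans)
open import Relation.Binary.Lattice using (MeetSemilattice)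
open import Relation.Binary.Lattice.Properties.MeetSemilattice using (≈-dec⇒≤-dec)
open import Relation.Binary.PropositionalEquality
  using (_≡_; refl; sym; trans; cong; cong₂; module ≡-Reasoning)
open import Relation.Binary.PropositionalEquality.Algebra using (isMagma)
open import Relation.Nullary.Decidable
  using (Dec; does; yes; no; dec-true; dec-false; via-injection)
open import Defs

open import Algebra.Lattice.Properties.BooleanAlgebra ∨-∧-booleanAlgebra
  using (deMorgan₁; deMorgan₂)
open import Algebra.Properties.CommutativeSemigroup
  (CommutativeMonoid.commutativeSemigroup ∧-commutativeMonoid) using (interchange)

private
  variable
    n : ℕ
    X : Set

⋁ : (Fin n → Bool) → Bool
⋁ = foldr _∨_ false

⋁-cong : {p q : Fin n → Bool} → (∀ i → p i ≡ q i) → ⋁ p ≡ ⋁ q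
⋁-cong = foldr-cong {R = _≡_} {S = _≡_} (cong₂ _∨_) refl

⋁-false : ⋁ {n} (λ _ → false) ≡ false
⋁-false {zero}  = refl
⋁-false {suc n} = ⋁-false {n}

⋁-select : (k : Fin n) (q : Fin n → Bool) → ⋁ (λ i → does (k ≟ i) ∧ q i) ≡ q k
⋁-select {suc n} zero    q = trans (cong (q zero ∨_) (⋁-false {n})) (∨-identityʳ (q zero))
⋁-select         (suc k) q = ⋁-select k (q ∘ suc)

not-⋁-∧-not : (s q : Fin n → Bool) →
              not (⋁ (λ i → s i ∧ not (q i))) ≡ foldr _∧_ true (λ i → if s i then q i else true)
not-⋁-∧-not {zero}  s q = refl
not-⋁-∧-not {suc n} s q =
  trans (deMorgan₂ (s zero ∧ not (q zero)) _)
        (cong₂ _∧_ (not-∧-not (s zero)) (not-⋁-∧-not (s ∘ suc) (q ∘ suc)))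
  where
  not-∧-not : ∀ b → not (b ∧ not (q zero)) ≡ (if b then q zero else true)
  not-∧-not true  = not-involutive (q zero)
  not-∧-not false = refl

-- ◇ φ p holds iff p meets every member of φ.
◇ : Filter X → (X → Bool) → Bool
◇ φ p = not (h φ (not ∘ p))

module _ (φ : Filter X) where

  ◇-resp : {p q : X → Bool} → (∀ x → p x ≡ q x) → ◇ φ p ≡ ◇ φ q
  ◇-resp e = cong not (resp φ _ _ (cong not ∘ e))

  h-via-◇ : (p : X → Bool) → h φ p ≡ not (◇ φ (not ∘ p))
  h-via-◇ p = sym (trans (not-involutive _) (resp φ _ _ (not-involutive ∘ p)))

  ◇-false : ◇ φ (λ _ → false) ≡ false
  ◇-false = cong not (pres⊤ φ)

  ◇-∨ : (p q : X → Bool) → ◇ φ (λ x → p x ∨ q x) ≡ ◇ φ p ∨ ◇ φ q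
  ◇-∨ p q = begin
    not (h φ (λ x → not (p x ∨ q x)))        ≡⟨ cong not (resp φ _ _ (λ x → deMorgan₂ (p x) (q x))) ⟩
    not (h φ (λ x → not (p x) ∧ not (q x)))  ≡⟨ cong not (pres∧ φ _ _) ⟩
    not (h φ (not ∘ p) ∧ h φ (not ∘ q))      ≡⟨ deMorgan₁ (h φ (not ∘ p)) _ ⟩
    ◇ φ p ∨ ◇ φ q                            ∎
    where open ≡-Reasoning

  ◇-∧-const : (p : X → Bool) (c : Bool) → ◇ φ (λ x → p x ∧ c) ≡ ◇ φ p ∧ c
  ◇-∧-const p true  = trans (◇-resp (∧-identityʳ ∘ p)) (sym (∧-identityʳ _))
  ◇-∧-const p false = trans (◇-resp (∧-zeroʳ ∘ p)) (trans ◇-false (sym (∧-zeroʳ _)))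

  ◇-⋁ : (g : Fin n → X → Bool) → ◇ φ (λ x → ⋁ (λ i → g i x)) ≡ ⋁ (λ i → ◇ φ (g i))
  ◇-⋁ {zero}  g = ◇-false
  ◇-⋁ {suc n} g = trans (◇-∨ (g zero) _) (cong (◇ φ (g zero) ∨_) (◇-⋁ (g ∘ suc)))

◇-injective : (φ ψ : Filter X) → (∀ p → ◇ φ p ≡ ◇ ψ p) → φ ≈F ψ
◇-injective φ ψ e p =
  trans (h-via-◇ φ p) (trans (cong not (e (not ∘ p))) (sym (h-via-◇ ψ p)))

◇-ηF : (x : X) (p : X → Bool) → ◇ (ηF X x) p ≡ p x
◇-ηF x p = not-involutive (p x)

◇-μF : (Φ : Filter (Filter X)) (p : X → Bool) → ◇ (μF Φ) p ≡ ◇ Φ (λ φ → ◇ φ p)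
◇-μF Φ p = cong not (resp Φ _ _ (λ φ → sym (not-involutive _)))

module _ (d : (X → Bool) → Bool)
         (d-resp : ∀ {p q} → (∀ x → p x ≡ q x) → d p ≡ d q)
         (d-false : d (λ _ → false) ≡ false)
         (d-∨ : ∀ p q → d (λ x → p x ∨ q x) ≡ d p ∨ d q) where

  dualFilter : Filter X
  dualFilter = record
    { h     = λ p → not (d (not ∘ p))
    ; resp  = λ p q e → cong not (d-resp (cong not ∘ e))
    ; pres⊤ = cong not d-false
    ; pres∧ = λ p q → trans (cong not (trans (d-resp (λ x → deMorgan₁ (p x) (q x)))
                                             (d-∨ (not ∘ p) (not ∘ q))))
                            (deMorgan₂ (d (not ∘ p)) _)
    }

  ◇-dualFilter : (p : X → Bool) → ◇ dualFilter p ≡ d p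
  ◇-dualFilter p = trans (not-involutive _) (d-resp (not-involutive ∘ p))

supp : Filter (Fin n) → Fin n → Bool
supp ψ i = ◇ ψ (λ k → does (k ≟ i))

◇-principal : (ψ : Filter (Fin n)) (p : Fin n → Bool) → ◇ ψ p ≡ ⋁ (λ i → supp ψ i ∧ p i)
◇-principal ψ p = begin
  ◇ ψ p                                      ≡⟨ ◇-resp ψ (λ k → sym (⋁-select k p)) ⟩
  ◇ ψ (λ k → ⋁ (λ i → does (k ≟ i) ∧ p i))  ≡⟨ ◇-⋁ ψ (λ i k → does (k ≟ i) ∧ p i) ⟩
  ⋁ (λ i → ◇ ψ (λ k → does (k ≟ i) ∧ p i))  ≡⟨ ⋁-cong (λ i → ◇-∧-const ψ _ (p i)) ⟩
  ⋁ (λ i → supp ψ i ∧ p i)                   ∎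
  where open ≡-Reasoning

h-principal : (ψ : Filter (Fin n)) (p : Fin n → Bool) →
              h ψ p ≡ foldr _∧_ true (λ i → if supp ψ i then p i else true)
h-principal ψ p =
  trans (h-via-◇ ψ p) (trans (cong not (◇-principal ψ (not ∘ p))) (not-⋁-∧-not (supp ψ) p))

𝟚 : MSL
𝟚 = record
  { Carrier = Bool ; _⊓_ = _∧_ ; top = true
  ; ⊓-assoc = ∧-assoc ; ⊓-comm = ∧-comm ; ⊓-idem = ∧-idem ; top-max = ∧-identityʳ
  }

module _ (M : MSL) where
  open MSL M

  semilattice : Semilattice _ _
  semilattice = record
    { _∙_           = _⊓_
    ; isSemilattice = record
      { isBand = record
        { isSemigroup = record { isMagma = isMagma _⊓_ ; assoc = ⊓-assoc }
        ; idem        = ⊓-idem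
        }
      ; comm   = ⊓-comm
      }
    }

  ⋀ : (Fin n → Carrier) → Carrier
  ⋀ = foldr _⊓_ top

  ⋀-cong : {g g′ : Fin n → Carrier} → (∀ i → g i ≡ g′ i) → ⋀ g ≡ ⋀ g′
  ⋀-cong = foldr-cong {R = _≡_} {S = _≡_} (cong₂ _⊓_) refl

  ⋀supp : Filter (Fin n) → (Fin n → Carrier) → Carrier
  ⋀supp ψ g = ⋀ (λ i → if supp ψ i then g i else top)

module _ {M N : MSL} (f : MSL-Hom M N) where
  open MSL-Hom f
  private
    module M = MSL M
    module N = MSL N

  hom-guard : (b : Bool) (x : M.Carrier) →
              fun (if b then x else M.top) ≡ (if b then fun x else N.top)
  hom-guard true  x = refl
  hom-guard false x = prestop

  hom-⋀ : (g : Fin n → M.Carrier) → fun (⋀ M g) ≡ ⋀ N (fun ∘ g)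
  hom-⋀ {zero}  g = prestop
  hom-⋀ {suc n} g = trans (pres⊓ _ _) (cong (fun (g zero) N.⊓_) (hom-⋀ (g ∘ suc)))

  hom-⋀supp : (ψ : Filter (Fin n)) (g : Fin n → M.Carrier) →
              fun (⋀supp M ψ g) ≡ ⋀supp N ψ (fun ∘ g)
  hom-⋀supp ψ g = trans (hom-⋀ (λ i → if supp ψ i then g i else M.top))
                        (⋀-cong N (λ i → hom-guard (supp ψ i) (g i)))

⟦_⟧ : FinMSL → Set
⟦ M ⟧ = MSL.Carrier (FinMSL.msl M)

⋀over : (M : FinMSL) (N : MSL) → Filter ⟦ M ⟧ → (⟦ M ⟧ → MSL.Carrier N) → MSL.Carrier N
⋀over M N φ g = ⋀supp N (mapF to φ) (g ∘ from)
  where open Inverse (FinMSL.finite M)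

module FinOrder (N : FinMSL) where
  open FinMSL N using (msl; finite)
  open MSL msl
  open MeetSemilattice (∧-orderTheoreticMeetSemilattice (semilattice msl))
    using (_≤_; x∧y≤x; x∧y≤y; ∧-greatest)
    renaming (refl to ≤-refl; trans to ≤-trans; antisym to ≤-antisym)

  _≤?_ : (x y : Carrier) → Dec (x ≤ y)
  _≤?_ = ≈-dec⇒≤-dec (∧-orderTheoreticMeetSemilattice (semilattice msl))
                     (via-injection (↔⇒↣ finite) _≟_)

  ↑ : Carrier → Carrier → Bool
  ↑ m x = does (m ≤? x)

  ≤-from-↑ : ∀ {m x} → ↑ m x ≡ true → m ≤ x
  ≤-from-↑ {m} {x} e with m ≤? x | e
  ... | yes m≤x | _  = m≤x
  ... | no _    | ()

  ↑-injective : ∀ {x y} → (∀ m → ↑ m x ≡ ↑ m y) → x ≡ y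
  ↑-injective {x} {y} e =
    ≤-antisym (≤-from-↑ (trans (sym (e x)) (↑-refl x))) (≤-from-↑ (trans (e y) (↑-refl y)))
    where
    ↑-refl : ∀ z → ↑ z z ≡ true
    ↑-refl z = dec-true (z ≤? z) ≤-refl

  ↑-⊓ : ∀ m x y → ↑ m (x ⊓ y) ≡ ↑ m x ∧ ↑ m y
  ↑-⊓ m x y with m ≤? x | m ≤? y
  ... | yes m≤x | yes m≤y = dec-true (m ≤? (x ⊓ y)) (∧-greatest m≤x m≤y)
  ... | no m≰x  | _       = dec-false (m ≤? (x ⊓ y)) (λ m≤x⊓y → m≰x (≤-trans m≤x⊓y (x∧y≤x x y)))
  ... | yes _   | no m≰y  = dec-false (m ≤? (x ⊓ y)) (λ m≤x⊓y → m≰y (≤-trans m≤x⊓y (x∧y≤y x y)))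

  ↑-hom : Carrier → MSL-Hom msl 𝟚
  ↑-hom m = record
    { fun = ↑ m ; pres⊓ = ↑-⊓ m ; prestop = dec-true (m ≤? top) (sym (top-max m)) }

  ↑-⋀over : (M : FinMSL) (φ : Filter ⟦ M ⟧) (g : ⟦ M ⟧ → Carrier) (m : Carrier) →
            ↑ m (⋀over M msl φ g) ≡ h φ (↑ m ∘ g)
  ↑-⋀over M φ g m = begin
    ↑ m (⋀over M msl φ g)                 ≡⟨ hom-⋀supp (↑-hom m) (mapF to φ) (g ∘ from) ⟩
    ⋀supp 𝟚 (mapF to φ) (↑ m ∘ g ∘ from)  ≡⟨ sym (h-principal (mapF to φ) (↑ m ∘ g ∘ from)) ⟩
    h φ (↑ m ∘ g ∘ from ∘ to)             ≡⟨ resp φ _ _ (cong (↑ m ∘ g) ∘ strictlyInverseʳ) ⟩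
    h φ (↑ m ∘ g)                         ∎
    where
    open ≡-Reasoning
    open Inverse (FinMSL.finite M) using (to; from; strictlyInverseʳ)

εMSL : (M : FinMSL) → Filter ⟦ M ⟧ → ⟦ M ⟧
εMSL M φ = ⋀over M (FinMSL.msl M) φ id

module _ (M : FinMSL) where
  open FinOrder M

  ↑-εMSL : (φ : Filter ⟦ M ⟧) (m : ⟦ M ⟧) → ↑ m (εMSL M φ) ≡ h φ (↑ m)
  ↑-εMSL φ = ↑-⋀over M φ id

  εMSL-resp : (φ ψ : Filter ⟦ M ⟧) → φ ≈F ψ → εMSL M φ ≡ εMSL M ψ
  εMSL-resp φ ψ e = ↑-injective (λ m → trans (↑-εMSL φ m) (trans (e (↑ m)) (sym (↑-εMSL ψ m))))

  εMSL-ηF : (x : ⟦ M ⟧) → εMSL M (ηF ⟦ M ⟧ x) ≡ x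
  εMSL-ηF x = ↑-injective (↑-εMSL (ηF ⟦ M ⟧ x))

  εMSL-μF : (Φ : Filter (Filter ⟦ M ⟧)) → εMSL M (μF Φ) ≡ εMSL M (mapF (εMSL M) Φ)
  εMSL-μF Φ = ↑-injective (λ m → begin
    ↑ m (εMSL M (μF Φ))                ≡⟨ ↑-εMSL (μF Φ) m ⟩
    h Φ (λ φ → h φ (↑ m))              ≡⟨ resp Φ _ _ (λ φ → sym (↑-εMSL φ m)) ⟩
    h Φ (λ φ → ↑ m (εMSL M φ))         ≡⟨ sym (↑-εMSL (mapF (εMSL M) Φ) m) ⟩
    ↑ m (εMSL M (mapF (εMSL M) Φ))     ∎)
    where open ≡-Reasoning

εMSL-natural : {M N : FinMSL} (f : MSL-Hom (FinMSL.msl M) (FinMSL.msl N)) (φ : Filter ⟦ M ⟧) →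
               εMSL N (mapF (MSL-Hom.fun f) φ) ≡ MSL-Hom.fun f (εMSL M φ)
εMSL-natural {M} {N} f φ = ↑-injective (λ n → begin
  ↑ n (εMSL N (mapF (fun f) φ))           ≡⟨ ↑-εMSL N (mapF (fun f) φ) n ⟩
  h φ (↑ n ∘ fun f)                       ≡⟨ sym (↑-⋀over M φ (fun f) n) ⟩
  ↑ n (⋀over M (FinMSL.msl N) φ (fun f))  ≡⟨ cong (↑ n) (sym (hom-⋀supp f (mapF to φ) from)) ⟩
  ↑ n (fun f (εMSL M φ))                  ∎)
  where
  open FinOrder N
  open MSL-Hom
  open Inverse (FinMSL.finite M) using (to; from)
  open ≡-Reasoning

counitMSL : Counit U-MSLf
counitMSL = record
  { ε      = εMSL
  ; ε-resp = εMSL-resp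
  ; ε-nat  = λ {M} {N} → εMSL-natural {M} {N}
  }

𝟚ᶠ : FinMSL
𝟚ᶠ = record { msl = 𝟚 ; size = 2 ; finite = ↔-sym 2↔Bool }

εMSL-𝟚 : (φ : Filter Bool) → εMSL 𝟚ᶠ φ ≡ h φ id
εMSL-𝟚 φ = trans (sym (↑-true _)) (trans (↑-εMSL 𝟚ᶠ φ true) (resp φ _ _ ↑-true))
  where
  open FinOrder 𝟚ᶠ
  ↑-true : ∀ b → ↑ true b ≡ b
  ↑-true true  = dec-true (true ≤? true) refl
  ↑-true false = dec-false (true ≤? false) (λ ())

_×ᴹ_ : MSL → MSL → MSL
M ×ᴹ N = record
  { Carrier = M.Carrier × N.Carrier
  ; _⊓_     = λ x y → proj₁ x M.⊓ proj₁ y , proj₂ x N.⊓ proj₂ y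
  ; top     = M.top , N.top
  ; ⊓-assoc = λ x y z → cong₂ _,_ (M.⊓-assoc _ _ _) (N.⊓-assoc _ _ _)
  ; ⊓-comm  = λ x y → cong₂ _,_ (M.⊓-comm _ _) (N.⊓-comm _ _)
  ; ⊓-idem  = λ x → cong₂ _,_ (M.⊓-idem _) (N.⊓-idem _)
  ; top-max = λ x → cong₂ _,_ (M.top-max _) (N.top-max _)
  }
  where
  module M = MSL M
  module N = MSL N

_×ᶠ_ : FinMSL → FinMSL → FinMSL
M ×ᶠ N = record
  { msl    = M.msl ×ᴹ N.msl
  ; size   = M.size * N.size
  ; finite = ↔-trans (M.finite ×-↔ N.finite) (↔-sym *↔×)
  }
  where
  module M = FinMSL M
  module N = FinMSL N

module _ {M N : MSL} where

  proj₁-hom : MSL-Hom (M ×ᴹ N) M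
  proj₁-hom = record { fun = proj₁ ; pres⊓ = λ _ _ → refl ; prestop = refl }

  proj₂-hom : MSL-Hom (M ×ᴹ N) N
  proj₂-hom = record { fun = proj₂ ; pres⊓ = λ _ _ → refl ; prestop = refl }

  top-hom : MSL-Hom M N
  top-hom = record { fun = λ _ → MSL.top N ; pres⊓ = λ _ _ → sym (MSL.⊓-idem N _) ; prestop = refl }

∧-hom : MSL-Hom (𝟚 ×ᴹ 𝟚) 𝟚
∧-hom = record
  { fun     = λ x → proj₁ x ∧ proj₂ x
  ; pres⊓   = λ x y → interchange (proj₁ x) (proj₁ y) (proj₂ x) (proj₂ y)
  ; prestop = refl
  }

module _ {o ℓ} {K : SetFunctor o ℓ} {G : Endo} (A : NatGK K G) where
  open SetFunctor K
  open Endo G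
  open NatGK A

  α-∘ : ∀ {a b X} (f : Hom a b) (r : X → ob a) (x : F₀ X) →
        α b (F₁ (map f ∘ r) x) ≡ map f (α a (F₁ r x))
  α-∘ f r x = trans (cong (α _) (F-∘ r (map f) x)) (nat f (F₁ r x))

module _ (G : Endo) (A : NatGK U-MSLf G) where
  open Endo G
  open NatGK A

  σMSL : (X : Set) → F₀ X → Filter X
  σMSL X x = record
    { h     = λ p → α 𝟚ᶠ (F₁ p x)
    ; resp  = λ p q e → cong (α 𝟚ᶠ) (F-resp e x)
    ; pres⊤ = α-∘ A {a = 𝟚ᶠ} top-hom (λ _ → true) x
    ; pres∧ = λ p q →
        trans (α-∘ A {a = 𝟚ᶠ ×ᶠ 𝟚ᶠ} ∧-hom < p , q > x)
              (cong₂ _∧_ (sym (α-∘ A {a = 𝟚ᶠ ×ᶠ 𝟚ᶠ} proj₁-hom < p , q > x))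
                         (sym (α-∘ A {a = 𝟚ᶠ ×ᶠ 𝟚ᶠ} proj₂-hom < p , q > x)))
    }

  σMSL-natural : NatToF G
  σMSL-natural = record { σ = σMSL ; σ-nat = λ f x p → cong (α 𝟚ᶠ) (sym (F-∘ f p x)) }

  εMSL-σMSL : (M : FinMSL) (x : F₀ ⟦ M ⟧) → εMSL M (σMSL _ x) ≡ α M x
  εMSL-σMSL M x = ↑-injective (λ m → trans (↑-εMSL M (σMSL _ x) m) (nat (↑-hom m) x))
    where open FinOrder M

  σMSL-unique : (s : NatToF G) → (∀ M x → εMSL M (NatToF.σ s ⟦ M ⟧ x) ≡ α M x) →
                (X : Set) (x : F₀ X) → NatToF.σ s X x ≈F σMSL X x
  σMSL-unique s s-factors X x p = begin
    h (σ X x) p                ≡⟨ sym (σ-nat p x id) ⟩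
    h (σ Bool (F₁ p x)) id     ≡⟨ sym (εMSL-𝟚 (σ Bool (F₁ p x))) ⟩
    εMSL 𝟚ᶠ (σ Bool (F₁ p x))  ≡⟨ s-factors 𝟚ᶠ (F₁ p x) ⟩
    α 𝟚ᶠ (F₁ p x)              ∎
    where
    open NatToF s
    open ≡-Reasoning

isRanMSL : IsRan U-MSLf counitMSL
isRanMSL G A = (σMSL-natural G A , εMSL-σMSL G A) , λ s t s-factors t-factors X x p →
  trans (σMSL-unique G A s s-factors X x p) (sym (σMSL-unique G A t t-factors X x p))

filterCodensity-MSLf : IsFilterCodensity U-MSLf
filterCodensity-MSLf = counitMSL , isRanMSL , εMSL-ηF , εMSL-μF

lookup-♯ : {m k : ℕ} (f : Fin m → Subset k) (A : Subset m) (j : Fin k) →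
           lookup ((f ♯) A) j ≡ ⋁ (λ i → lookup A i ∧ lookup (f i) j)
lookup-♯ f []      j = lookup-replicate j false
lookup-♯ f (b ∷ A) j =
  trans (lookup-zipWith _∨_ j (if b then f zero else ∅) (((f ∘ suc) ♯) A))
        (cong₂ _∨_ (lookup-if b) (lookup-♯ (f ∘ suc) A j))
  where
  lookup-if : ∀ b → lookup (if b then f zero else ∅) j ≡ b ∧ lookup (f zero) j
  lookup-if true  = refl
  lookup-if false = lookup-replicate j false

tabulate-≡ : {A : Set} {g : Fin n → A} {v : Vec A n} → (∀ i → g i ≡ lookup v i) → tabulate g ≡ v
tabulate-≡ {v = v} e = trans (tabulate-cong e) (tabulate∘lookup v)

εKl : (n : ℕ) → Filter (Subset n) → Subset n
εKl n φ = tabulate (λ i → ◇ φ (λ A → lookup A i))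

εKl-natural : {m k : ℕ} (f : Fin m → Subset k) (φ : Filter (Subset m)) →
              εKl k (mapF (f ♯) φ) ≡ (f ♯) (εKl m φ)
εKl-natural {m} f φ = tabulate-≡ (λ j → begin
  ◇ φ (λ A → lookup ((f ♯) A) j)                     ≡⟨ ◇-resp φ (λ A → lookup-♯ f A j) ⟩
  ◇ φ (λ A → ⋁ (λ i → lookup A i ∧ lookup (f i) j))  ≡⟨ ◇-⋁ φ (λ i A → lookup A i ∧ lookup (f i) j) ⟩
  ⋁ (λ i → ◇ φ (λ A → lookup A i ∧ lookup (f i) j))  ≡⟨ ⋁-cong (λ i → ◇-∧-lookup i (lookup (f i) j)) ⟩
  ⋁ (λ i → lookup (εKl m φ) i ∧ lookup (f i) j)      ≡⟨ sym (lookup-♯ f (εKl m φ) j) ⟩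
  lookup ((f ♯) (εKl m φ)) j                         ∎)
  where
  open ≡-Reasoning
  ◇-∧-lookup : ∀ i c → ◇ φ (λ A → lookup A i ∧ c) ≡ lookup (εKl m φ) i ∧ c
  ◇-∧-lookup i c = trans (◇-∧-const φ (λ A → lookup A i) c) (cong (_∧ c) (sym (lookup∘tabulate _ i)))

εKl-ηF : (n : ℕ) (A : Subset n) → εKl n (ηF (Subset n) A) ≡ A
εKl-ηF n A = tabulate-≡ (λ i → ◇-ηF A (λ B → lookup B i))

εKl-μF : (n : ℕ) (Φ : Filter (Filter (Subset n))) → εKl n (μF Φ) ≡ εKl n (mapF (εKl n) Φ)
εKl-μF n Φ = tabulate-cong (λ i →
  trans (◇-μF Φ (λ A → lookup A i)) (◇-resp Φ (λ φ → sym (lookup∘tabulate _ i))))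

counitKl : Counit U-KlPf
counitKl = record
  { ε      = εKl
  ; ε-resp = λ n φ ψ e → tabulate-cong (λ i → cong not (e _))
  ; ε-nat  = εKl-natural
  }

module _ (G : Endo) (A : NatGK U-KlPf G) where
  open Endo G
  open NatGK A

  ◇α : F₀ X → (X → Bool) → Bool
  ◇α x p = lookup (α 1 (F₁ (λ y → p y ∷ []) x)) zero

  module _ (x : F₀ X) where

    ◇α-resp : {p q : X → Bool} → (∀ y → p y ≡ q y) → ◇α x p ≡ ◇α x q
    ◇α-resp e = cong (λ v → lookup (α 1 v) zero) (F-resp (λ y → cong (_∷ []) (e y)) x)

    ◇α-♯ : (f : Fin n → Subset 1) (r : X → Subset n) →
           ◇α x (λ y → lookup ((f ♯) (r y)) zero) ≡ lookup ((f ♯) (α n (F₁ r x))) zero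
    ◇α-♯ f r =
      trans (cong (λ v → lookup (α 1 v) zero) (F-resp (λ y → tabulate∘lookup ((f ♯) (r y))) x))
            (cong (λ v → lookup v zero) (α-∘ A f r x))

    ◇α-lookup : (r : X → Subset n) (k : Fin n) →
                ◇α x (λ y → lookup (r y) k) ≡ lookup (α n (F₁ r x)) k
    ◇α-lookup r k = trans (◇α-resp (λ y → sym (lookup-π♯ (r y)))) (trans (◇α-♯ π r) (lookup-π♯ _))
      where
      π : Fin _ → Subset 1
      π i = does (k ≟ i) ∷ []
      lookup-π♯ : ∀ B → lookup ((π ♯) B) zero ≡ lookup B k
      lookup-π♯ B = trans (lookup-♯ π B zero)
                          (trans (⋁-cong (λ i → ∧-comm (lookup B i) _)) (⋁-select k (lookup B)))

    ◇α-⋁ : (c : Fin n → Bool) (r : X → Subset n) →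
           ◇α x (λ y → ⋁ (λ i → lookup (r y) i ∧ c i)) ≡ ⋁ (λ i → ◇α x (λ y → lookup (r y) i) ∧ c i)
    ◇α-⋁ c r = begin
      ◇α x (λ y → ⋁ (λ i → lookup (r y) i ∧ c i))  ≡⟨ ◇α-resp (λ y → sym (lookup-♯ f (r y) zero)) ⟩
      ◇α x (λ y → lookup ((f ♯) (r y)) zero)       ≡⟨ ◇α-♯ f r ⟩
      lookup ((f ♯) (α _ (F₁ r x))) zero           ≡⟨ lookup-♯ f _ zero ⟩
      ⋁ (λ i → lookup (α _ (F₁ r x)) i ∧ c i)      ≡⟨ ⋁-cong (λ i → cong (_∧ c i) (sym (◇α-lookup r i))) ⟩
      ⋁ (λ i → ◇α x (λ y → lookup (r y) i) ∧ c i)  ∎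
      where
      open ≡-Reasoning
      f : Fin _ → Subset 1
      f i = c i ∷ []

    ◇α-false : ◇α x (λ _ → false) ≡ false
    ◇α-false = ◇α-⋁ {n = 0} (λ ()) (λ _ → [])

    ◇α-∨ : (p q : X → Bool) → ◇α x (λ y → p y ∨ q y) ≡ ◇α x p ∨ ◇α x q
    ◇α-∨ p q = trans (◇α-resp (λ y → sym (∨-as-⋁ (p y) (q y))))
                     (trans (◇α-⋁ (λ _ → true) (λ y → p y ∷ q y ∷ [])) (∨-as-⋁ (◇α x p) (◇α x q)))
      where
      ∨-as-⋁ : ∀ a b → ⋁ (λ i → lookup (a ∷ b ∷ []) i ∧ true) ≡ a ∨ b
      ∨-as-⋁ true  b     = refl
      ∨-as-⋁ false true  = refl
      ∨-as-⋁ false false = refl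

    σKl : Filter X
    σKl = dualFilter (◇α x) ◇α-resp ◇α-false ◇α-∨

    ◇-σKl : (p : X → Bool) → ◇ σKl p ≡ ◇α x p
    ◇-σKl = ◇-dualFilter (◇α x) ◇α-resp ◇α-false ◇α-∨

  σKl-natural : NatToF G
  σKl-natural = record
    { σ     = λ X → σKl {X}
    ; σ-nat = λ f x → ◇-injective (σKl (F₁ f x)) (mapF f (σKl x)) (λ p →
        trans (◇-σKl (F₁ f x) p)
              (trans (cong (λ v → lookup (α 1 v) zero) (sym (F-∘ f _ x))) (sym (◇-σKl x (p ∘ f)))))
    }

  εKl-σKl : (n : ℕ) (x : F₀ (Subset n)) → εKl n (σKl x) ≡ α n x
  εKl-σKl n x = tabulate-≡ (λ i →
    trans (◇-σKl x (λ B → lookup B i))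
          (trans (◇α-lookup x id i) (cong (λ v → lookup (α n v) i) (F-id x))))

  σKl-unique : (s : NatToF G) → (∀ n x → εKl n (NatToF.σ s (Subset n) x) ≡ α n x) →
               (X : Set) (x : F₀ X) → NatToF.σ s X x ≈F σKl {X} x
  σKl-unique s s-factors X x = ◇-injective (σ X x) (σKl x) (λ p → trans (◇-σ p) (sym (◇-σKl x p)))
    where
    open NatToF s
    ◇-σ : ∀ p → ◇ (σ X x) p ≡ ◇α x p
    ◇-σ p = trans (cong not (sym (σ-nat (λ y → p y ∷ []) x (λ B → not (lookup B zero)))))
                  (cong (λ v → lookup v zero) (s-factors 1 (F₁ (λ y → p y ∷ []) x)))

isRanKl : IsRan U-KlPf counitKl
isRanKl G A = (σKl-natural G A , εKl-σKl G A) , λ s t s-factors t-factors X x p →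
  trans (σKl-unique G A s s-factors X x p) (sym (σKl-unique G A t t-factors X x p))

filterCodensity-KlPf : IsFilterCodensity U-KlPf
filterCodensity-KlPf = counitKl , isRanKl , εKl-ηF , εKl-μF

theorem4p3 : IsFilterCodensity U-MSLf × IsFilterCodensity U-KlPf
theorem4p3 = filterCodensity-MSLf , filterCodensity-KlPf
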